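{- Let $n, k$ be natural numbers with $k < n$, and let $G$ be a graph on $n$ vertices that contains every tree on $k$ vertices as an induced subgraph (up to isomorphism). Let $\mathcal{M}$ be a set of adjacency matrices containing exactly one adjacency matrix of each isomorphism class of graphs on $n-k$ vertices. Then there is a graph $G'$ with vertex set $\{1, \dots, n\}$, isomorphic to $G$, such that: (i) vertex $1$ is adjacent to each of $2, \dots, k$, and the vertices $2, \dots, k$ are pairwise non-adjacent (so $\{1,\dots,k\}$ induces the star $S_{k-1}$ with centre $1$); (ii) the adjacency matrix of the subgraph of $G'$ induced by $\{k+1, \dots, n\}$ (with vertices in increasing order) is equal to a matrix in $\mathcal{M}$; and (iii) for $i \in \{2, \dots, k\}$, writing $x_{i,j} \in \{0,1\}$ for the adjacency indicator between vertex $i$ and vertex $k+j$ ($1 \le j \le n-k$), and letting $N_i$ be the integer whose binary representation is $x_{i,1} x_{i,2} \cdots x_{i,n-k}$ (with $x_{i,n-k}$ the least significant digit), we have $N_2 \leq N_3 \leq \dots \leq N_k$.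
   Context: All graphs are finite and simple. The star $S_{k-1}$ is the tree on $k$ vertices consisting of one vertex adjacent to all $k-1$ others, with no other edges. -}

module Defs where

open import Data.Nat using (ℕ; zero; suc; _+_; _∸_; _^_; _≤_; _<_)
open import Data.Nat.Properties using (+-monoʳ-<; m+[n∸m]≡n; <⇒≤)
open import Data.Fin using (Fin; zero; suc; toℕ; fromℕ<; inject₁; fromℕ)
open import Data.Fin.Properties using (toℕ<n)
open import Data.Fin.Permutation using (Permutation′; _⟨$⟩ʳ_)
open import Data.Bool using (Bool; true; false; if_then_else_)
open import Data.Product using (Σ; _×_; _,_; ∃)
open import Function.Definitions using (Injective)
open import Relation.Nullary using (¬_)
open import Relation.Binary.PropositionalEquality using (_≡_; subst)

Mat : ℕ → Set
Mat m = Fin m → Fin m → Bool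

IsAdjMat : ∀ {m} → Mat m → Set
IsAdjMat {m} A = (∀ i j → A i j ≡ A j i) × (∀ i → A i i ≡ false)

record Graph (n : ℕ) : Set where
  field
    adj     : Mat n
    isGraph : IsAdjMat adj
open Graph public

_≐_ : ∀ {m} → Mat m → Mat m → Set
A ≐ B = ∀ i j → A i j ≡ B i j

IsoMat : ∀ {m} → Mat m → Mat m → Set
IsoMat {m} A B = Σ (Permutation′ m) λ σ → ∀ i j → B (σ ⟨$⟩ʳ i) (σ ⟨$⟩ʳ j) ≡ A i j

Iso : ∀ {n} → Graph n → Graph n → Set
Iso G H = IsoMat (adj G) (adj H)

data Walk {n} (G : Graph n) : Fin n → Fin n → Set where
  [] : ∀ {u} → Walk G u u
  _∷_ : ∀ {u v w} → adj G u v ≡ true → Walk G v w → Walk G u w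

Connected : ∀ {n} → Graph n → Set
Connected {n} G = ∀ (u v : Fin n) → Walk G u v

record Cycle {n} (G : Graph n) : Set where
  field
    len      : ℕ
    vert     : Fin (suc (suc (suc len))) → Fin n
    distinct : Injective _≡_ _≡_ vert
    step     : ∀ (i : Fin (suc (suc len))) → adj G (vert (inject₁ i)) (vert (suc i)) ≡ true
    close    : adj G (vert (fromℕ (suc (suc len)))) (vert zero) ≡ true

Acyclic : ∀ {n} → Graph n → Set
Acyclic G = ¬ Cycle G

IsTree : ∀ {k} → Graph k → Set
IsTree T = Connected T × Acyclic T

InducedSub : ∀ {k n} → Graph k → Graph n → Set
InducedSub {k} {n} H G =
  Σ (Fin k → Fin n) λ f → Injective _≡_ _≡_ f × (∀ a b → adj G (f a) (f b) ≡ adj H a b)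

-- Vertex k + j of Fin n, for j : Fin (n ∸ k)   (0-based indexing).
shift : ∀ {k n} → k < n → Fin (n ∸ k) → Fin n
shift {k} {n} k<n j =
  fromℕ< (subst (k + toℕ j <_) (m+[n∸m]≡n (<⇒≤ k<n)) (+-monoʳ-< k (toℕ<n j)))

lowerBlock : ∀ {k n} → k < n → Graph n → Mat (n ∸ k)
lowerBlock k<n G i j = adj G (shift k<n i) (shift k<n j)

binVal : (m : ℕ) → (Fin m → Bool) → ℕ
binVal zero    x = 0
binVal (suc m) x = (if x zero then 2 ^ m else 0) + binVal m (λ j → x (suc j))

module Submission where

-- The star S_{k-1} is a tree, so it occurs in G as an induced subgraph, and extending
-- that embedding to a permutation of all vertices moves the star onto 0, …, k-1 with
-- centre 0.  The graph induced on k, …, n-1 is isomorphic to some A ∈ M, and a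
-- permutation of those vertices makes the lower block equal to A.  Finally the leaves
-- 1, …, k-1 may be permuted freely without destroying the star, so sorting them by the
-- binary value of their rows towards the lower block gives (iii).  The last two
-- permutations act on disjoint blocks, so they are applied at once as one block
-- permutation, which keeps the star on top and the lower block intact.

open import Defs
open import Data.Nat using (ℕ; zero; suc; _+_; _∸_; _≤_; _<_; s≤s; _≤?_)
open import Data.Nat.Properties
  using (≤-refl; ≤-trans; ≤-<-trans; <-trans; <-irrefl; <⇒≤; ≰⇒>; m<1+n⇒m<n∨m≡n; m+[n∸m]≡n)
open import Data.Fin using (Fin; zero; suc; toℕ; fromℕ<; inject≤; cast; join; splitAt; _↑ˡ_; _↑ʳ_)
open import Data.Fin.Properties
  using (_≟_; toℕ-injective; toℕ-fromℕ<; toℕ-inject≤; toℕ-cast; toℕ-↑ˡ; toℕ-↑ʳ; toℕ<n;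
         inject≤-injective; cast-involutive; splitAt-join; +↔⊎)
open import Data.Fin.Permutation
  using (Permutation′; _⟨$⟩ʳ_; _⟨$⟩ˡ_; _∘ₚ_; id; flip; transpose; lift₀; cast-id; inverseʳ)
open import Data.Bool using (Bool; true; false; _xor_; if_then_else_)
open import Data.Empty using (⊥)
open import Data.Sum using (_⊎_; inj₁; inj₂; map)
open import Data.Sum.Function.Propositional using (_⊎-↔_)
open import Data.Product using (Σ; _×_; _,_; proj₁; proj₂)
open import Function using (_∘_)
open import Function.Construct.Composition using (_↔-∘_)
open import Function.Construct.Symmetry using (↔-sym)
open import Function.Definitions using (Injective)
open import Function.Consequences.Propositional using (contraInjective)
open import Relation.Nullary using (yes; no; contradiction)
open import Relation.Binary.PropositionalEquality
  using (_≡_; _≢_; refl; sym; trans; cong; cong₂; subst; subst₂; module ≡-Reasoning)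

relabel : ∀ {n} → Graph n → Permutation′ n → Graph n
relabel G π = record
  { adj     = λ x y → adj G (π ⟨$⟩ʳ x) (π ⟨$⟩ʳ y)
  ; isGraph = (λ x y → proj₁ (isGraph G) (π ⟨$⟩ʳ x) (π ⟨$⟩ʳ y))
            , (λ x → proj₂ (isGraph G) (π ⟨$⟩ʳ x))
  }

relabel-iso : ∀ {n} (G : Graph n) (π : Permutation′ n) → Iso G (relabel G π)
relabel-iso G π = flip π , λ x y → cong₂ (adj G) (inverseʳ π) (inverseʳ π)

binVal-cong : ∀ m {x y : Fin m → Bool} → (∀ j → x j ≡ y j) → binVal m x ≡ binVal m y
binVal-cong zero    x≗y = refl
binVal-cong (suc m) x≗y =
  cong₂ _+_ (cong (λ b → if b then _ else 0) (x≗y zero)) (binVal-cong m (x≗y ∘ suc))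

isCentre : ∀ {k} → Fin k → Bool
isCentre zero    = true
isCentre (suc _) = false

star : (k : ℕ) → Graph k
star k = record { adj = λ a b → isCentre a xor isCentre b ; isGraph = symmetric , irreflexive }
  where
  symmetric : ∀ (a b : Fin k) → isCentre a xor isCentre b ≡ isCentre b xor isCentre a
  symmetric zero    zero    = refl
  symmetric zero    (suc _) = refl
  symmetric (suc _) zero    = refl
  symmetric (suc _) (suc _) = refl

  irreflexive : ∀ (a : Fin k) → isCentre a xor isCentre a ≡ false
  irreflexive zero    = refl
  irreflexive (suc _) = refl

star-connected : ∀ {k} → Connected (star k)
star-connected zero    zero    = []
star-connected zero    (suc _) = refl ∷ []
star-connected (suc _) zero    = refl ∷ []
star-connected (suc _) (suc _) = _∷_ {v = zero} refl (refl ∷ [])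

-- Every edge of the star contains the centre, so a walk v₀ v₁ v₂ w must return to v₁
-- or have v₀ = v₂; a cycle of length ≥ 3 supplies such a walk with neither.
star-noLongWalk : ∀ {k} {v₀ v₁ v₂ w : Fin k} → v₀ ≢ v₂ → w ≢ v₁ →
  adj (star k) v₀ v₁ ≡ true → adj (star k) v₁ v₂ ≡ true → adj (star k) v₂ w ≡ true → ⊥
star-noLongWalk {v₁ = zero}  {v₂ = zero}                _    _    _  () _
star-noLongWalk {v₁ = zero}  {v₂ = suc _} {w = zero}    _    w≢v₁ _  _  _  = w≢v₁ refl
star-noLongWalk {v₁ = zero}  {v₂ = suc _} {w = suc _}   _    _    _  _  ()
star-noLongWalk {v₀ = zero}  {v₁ = suc _} {v₂ = zero}   v₀≢v₂ _   _  _  _  = v₀≢v₂ refl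
star-noLongWalk {v₀ = suc _} {v₁ = suc _}               _    _    () _  _
star-noLongWalk {v₁ = suc _} {v₂ = suc _}               _    _    _  () _

star-acyclic : ∀ {k} → Acyclic (star k)
star-acyclic record { len = zero ; distinct = distinct ; step = step ; close = close } =
  star-noLongWalk (contraInjective distinct λ ()) (contraInjective distinct λ ())
    (step zero) (step (suc zero)) close
star-acyclic record { len = suc _ ; distinct = distinct ; step = step } =
  star-noLongWalk (contraInjective distinct λ ()) (contraInjective distinct λ ())
    (step zero) (step (suc zero)) (step (suc (suc zero)))

star-isTree : ∀ {k} → IsTree (star k)
star-isTree = star-connected , star-acyclic

isCentre-fromℕ<-zero : ∀ {m k} (m<k : m < k) → m ≡ 0 → isCentre (fromℕ< m<k) ≡ true
isCentre-fromℕ<-zero (s≤s _) refl = refl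

isCentre-fromℕ<-suc : ∀ {m k} (m<k : m < k) → 1 ≤ m → isCentre (fromℕ< m<k) ≡ false
isCentre-fromℕ<-suc {suc _} (s≤s _) _ = refl

transpose-atˡ : ∀ {n} (i j : Fin n) → transpose i j ⟨$⟩ʳ i ≡ j
transpose-atˡ i j with i ≟ i
... | yes _   = refl
... | no  i≢i = contradiction refl i≢i

transpose-elsewhere : ∀ {n} (i j x : Fin n) → x ≢ i → x ≢ j → transpose i j ⟨$⟩ʳ x ≡ x
transpose-elsewhere i j x x≢i x≢j with x ≟ i
... | yes x≡i = contradiction x≡i x≢i
... | no  _ with x ≟ j
...   | yes x≡j = contradiction x≡j x≢j
...   | no  _   = refl

module _ {k n} (k≤n : k ≤ n) (f : Fin k → Fin n) (f-inj : Injective _≡_ _≡_ f) where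

  -- Each step swaps the next point of the prefix into the preimage of its target.
  extendInjection-prefix : ∀ j → j ≤ k → Σ (Permutation′ n) λ π →
    ∀ a → toℕ a < j → π ⟨$⟩ʳ inject≤ a k≤n ≡ f a
  extendInjection-prefix zero    _   = id , λ _ ()
  extendInjection-prefix (suc j) j<k with extendInjection-prefix j (<⇒≤ j<k)
  ... | π , π-agrees = transpose c y ∘ₚ π , agrees
    where
    aⱼ : Fin k
    aⱼ = fromℕ< j<k
    c y : Fin n
    c = inject≤ aⱼ k≤n
    y = π ⟨$⟩ˡ f aⱼ

    agrees : ∀ a → toℕ a < suc j → π ⟨$⟩ʳ (transpose c y ⟨$⟩ʳ inject≤ a k≤n) ≡ f a
    agrees a a<1+j with m<1+n⇒m<n∨m≡n a<1+j
    ... | inj₂ a≡j rewrite toℕ-injective (trans a≡j (sym (toℕ-fromℕ< j<k))) =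
      trans (cong (π ⟨$⟩ʳ_) (transpose-atˡ c y)) (inverseʳ π)
    ... | inj₁ a<j =
      trans (cong (π ⟨$⟩ʳ_) (transpose-elsewhere c y _ (a≢aⱼ ∘ inject≤-injective _ _ a aⱼ) a≢y))
            (π-agrees a a<j)
      where
      a≢aⱼ : a ≢ aⱼ
      a≢aⱼ a≡aⱼ = <-irrefl (trans (cong toℕ a≡aⱼ) (toℕ-fromℕ< j<k)) a<j

      a≢y : inject≤ a k≤n ≢ y
      a≢y a≡y = a≢aⱼ (f-inj (trans (sym (π-agrees a a<j)) (trans (cong (π ⟨$⟩ʳ_) a≡y) (inverseʳ π))))

  extendInjection : Σ (Permutation′ n) λ π → ∀ a → π ⟨$⟩ʳ inject≤ a k≤n ≡ f a
  extendInjection with extendInjection-prefix k ≤-refl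
  ... | π , π-agrees = π , λ a → π-agrees a (toℕ<n a)

argmin : ∀ k (key : Fin (suc k) → ℕ) → Σ (Fin (suc k)) λ c → ∀ a → key c ≤ key a
argmin zero    key = zero , λ { zero → ≤-refl }
argmin (suc k) key with argmin k (key ∘ suc)
... | c , c-min with key zero ≤? key (suc c)
...   | yes 0≤c = zero  , λ { zero → ≤-refl ; (suc a) → ≤-trans 0≤c (c-min a) }
...   | no  0≰c = suc c , λ { zero → <⇒≤ (≰⇒> 0≰c) ; (suc a) → c-min a }

sortingPermutation : ∀ k (key : Fin k → ℕ) → Σ (Permutation′ k) λ s →
  ∀ a b → toℕ a ≤ toℕ b → key (s ⟨$⟩ʳ a) ≤ key (s ⟨$⟩ʳ b)
sortingPermutation zero    key = id , λ ()
sortingPermutation (suc k) key with argmin k key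
... | c , c-min with sortingPermutation k (λ a → key (transpose zero c ⟨$⟩ʳ suc a))
...   | s , s-sorts = lift₀ s ∘ₚ transpose zero c , sorts
  where
  sorts : ∀ a b → toℕ a ≤ toℕ b →
    key ((lift₀ s ∘ₚ transpose zero c) ⟨$⟩ʳ a) ≤ key ((lift₀ s ∘ₚ transpose zero c) ⟨$⟩ʳ b)
  sorts zero    b       _         rewrite transpose-atˡ zero c = c-min _
  sorts (suc a) (suc b) (s≤s a≤b) = s-sorts a b a≤b

sortLeaves : ∀ k (key : Fin k → ℕ) → Σ (Permutation′ k) λ s →
  (∀ a → isCentre (s ⟨$⟩ʳ a) ≡ isCentre a) ×
  (∀ a b → 1 ≤ toℕ a → toℕ a ≤ toℕ b → key (s ⟨$⟩ʳ a) ≤ key (s ⟨$⟩ʳ b))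
sortLeaves zero    key = id , (λ ()) , λ ()
sortLeaves (suc k) key with sortingPermutation k (key ∘ suc)
... | s , s-sorts = lift₀ s , fixesCentre , sortsLeaves
  where
  fixesCentre : ∀ a → isCentre (lift₀ s ⟨$⟩ʳ a) ≡ isCentre a
  fixesCentre zero    = refl
  fixesCentre (suc _) = refl

  sortsLeaves : ∀ a b → 1 ≤ toℕ a → toℕ a ≤ toℕ b → key (lift₀ s ⟨$⟩ʳ a) ≤ key (lift₀ s ⟨$⟩ʳ b)
  sortsLeaves (suc a) (suc b) _ (s≤s a≤b) = s-sorts a b a≤b

lowerBlock-isAdjMat : ∀ {k n} (k<n : k < n) (G : Graph n) → IsAdjMat (lowerBlock k<n G)
lowerBlock-isAdjMat k<n G = (λ i j → proj₁ (isGraph G) _ _) , (λ i → proj₂ (isGraph G) _)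

module Blocks {k n : ℕ} (k<n : k < n) where
  open ≡-Reasoning

  private
    m : ℕ
    m = n ∸ k

    k+m≡n : k + m ≡ n
    k+m≡n = m+[n∸m]≡n (<⇒≤ k<n)

  top : Fin k → Fin n
  top a = inject≤ a (<⇒≤ k<n)

  top-fromℕ< : ∀ {x : Fin n} (x<k : toℕ x < k) → top (fromℕ< x<k) ≡ x
  top-fromℕ< x<k = toℕ-injective (trans (toℕ-inject≤ _ _) (toℕ-fromℕ< x<k))

  blockPermutation : Permutation′ k → Permutation′ m → Permutation′ n
  blockPermutation p q =
    cast-id k+m≡n ↔-∘ (↔-sym +↔⊎ ↔-∘ ((p ⊎-↔ q) ↔-∘ (+↔⊎ ↔-∘ cast-id (sym k+m≡n))))

  private
    cast-↑ˡ : ∀ a → cast k+m≡n (a ↑ˡ m) ≡ top a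
    cast-↑ˡ a = toℕ-injective (trans (toℕ-cast _ _) (trans (toℕ-↑ˡ a m) (sym (toℕ-inject≤ _ _))))

    cast-↑ʳ : ∀ j → cast k+m≡n (k ↑ʳ j) ≡ shift k<n j
    cast-↑ʳ j = toℕ-injective (trans (toℕ-cast _ _) (trans (toℕ-↑ʳ k j) (sym (toℕ-fromℕ< _))))

    blockPermutation-join : ∀ p q (s : Fin k ⊎ Fin m) →
      blockPermutation p q ⟨$⟩ʳ cast k+m≡n (join k m s)
        ≡ cast k+m≡n (join k m (map (p ⟨$⟩ʳ_) (q ⟨$⟩ʳ_) s))
    blockPermutation-join p q s = begin
      cast k+m≡n (join k m (map (p ⟨$⟩ʳ_) (q ⟨$⟩ʳ_)
        (splitAt k (cast (sym k+m≡n) (cast k+m≡n (join k m s))))))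
        ≡⟨ cong (λ x → cast k+m≡n (join k m (map (p ⟨$⟩ʳ_) (q ⟨$⟩ʳ_) (splitAt k x))))
                (cast-involutive (sym k+m≡n) k+m≡n _) ⟩
      cast k+m≡n (join k m (map (p ⟨$⟩ʳ_) (q ⟨$⟩ʳ_) (splitAt k (join k m s))))
        ≡⟨ cong (λ z → cast k+m≡n (join k m (map (p ⟨$⟩ʳ_) (q ⟨$⟩ʳ_) z))) (splitAt-join k m s) ⟩
      cast k+m≡n (join k m (map (p ⟨$⟩ʳ_) (q ⟨$⟩ʳ_) s)) ∎

  blockPermutation-top : ∀ p q a → blockPermutation p q ⟨$⟩ʳ top a ≡ top (p ⟨$⟩ʳ a)
  blockPermutation-top p q a = begin
    blockPermutation p q ⟨$⟩ʳ top a                 ≡⟨ cong (blockPermutation p q ⟨$⟩ʳ_) (sym (cast-↑ˡ a)) ⟩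
    blockPermutation p q ⟨$⟩ʳ cast k+m≡n (a ↑ˡ m)   ≡⟨ blockPermutation-join p q (inj₁ a) ⟩
    cast k+m≡n ((p ⟨$⟩ʳ a) ↑ˡ m)                    ≡⟨ cast-↑ˡ (p ⟨$⟩ʳ a) ⟩
    top (p ⟨$⟩ʳ a)                                  ∎

  blockPermutation-shift : ∀ p q j → blockPermutation p q ⟨$⟩ʳ shift k<n j ≡ shift k<n (q ⟨$⟩ʳ j)
  blockPermutation-shift p q j = begin
    blockPermutation p q ⟨$⟩ʳ shift k<n j           ≡⟨ cong (blockPermutation p q ⟨$⟩ʳ_) (sym (cast-↑ʳ j)) ⟩
    blockPermutation p q ⟨$⟩ʳ cast k+m≡n (k ↑ʳ j)   ≡⟨ blockPermutation-join p q (inj₂ j) ⟩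
    cast k+m≡n (k ↑ʳ (q ⟨$⟩ʳ j))                    ≡⟨ cast-↑ʳ (q ⟨$⟩ʳ j) ⟩
    shift k<n (q ⟨$⟩ʳ j)                            ∎

  StarOnTop : Graph n → Set
  StarOnTop G = ∀ a b → adj G (top a) (top b) ≡ adj (star k) a b

  row : Graph n → Fin n → ℕ
  row G x = binVal m (λ j → adj G x (shift k<n j))

  module _ (G : Graph n) (s : Permutation′ k) (τ : Permutation′ m) where

    relabel-starOnTop : StarOnTop G → (∀ a → isCentre (s ⟨$⟩ʳ a) ≡ isCentre a) →
      StarOnTop (relabel G (blockPermutation s τ))
    relabel-starOnTop G★ s-fixesCentre a b = begin
      adj G (blockPermutation s τ ⟨$⟩ʳ top a) (blockPermutation s τ ⟨$⟩ʳ top b)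
        ≡⟨ cong₂ (adj G) (blockPermutation-top s τ a) (blockPermutation-top s τ b) ⟩
      adj G (top (s ⟨$⟩ʳ a)) (top (s ⟨$⟩ʳ b))
        ≡⟨ G★ _ _ ⟩
      isCentre (s ⟨$⟩ʳ a) xor isCentre (s ⟨$⟩ʳ b)
        ≡⟨ cong₂ _xor_ (s-fixesCentre a) (s-fixesCentre b) ⟩
      isCentre a xor isCentre b ∎

    lowerBlock-relabel : ∀ i j →
      lowerBlock k<n (relabel G (blockPermutation s τ)) i j ≡ lowerBlock k<n G (τ ⟨$⟩ʳ i) (τ ⟨$⟩ʳ j)
    lowerBlock-relabel i j = cong₂ (adj G) (blockPermutation-shift s τ i) (blockPermutation-shift s τ j)

    row-relabel-top : ∀ a → row (relabel G (blockPermutation s τ)) (top a)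
      ≡ binVal m (λ j → adj G (top (s ⟨$⟩ʳ a)) (shift k<n (τ ⟨$⟩ʳ j)))
    row-relabel-top a = binVal-cong m λ j →
      cong₂ (adj G) (blockPermutation-top s τ a) (blockPermutation-shift s τ j)

  placeStarOnTop : (G : Graph n) → InducedSub (star k) G → Σ (Permutation′ n) λ π → StarOnTop (relabel G π)
  placeStarOnTop G (f , f-inj , f-star) with extendInjection (<⇒≤ k<n) f f-inj
  ... | π , π-extends = π , λ a b → trans (cong₂ (adj G) (π-extends a) (π-extends b)) (f-star a b)

  -- The leaves are sorted by their rows as they will be once τ has rearranged the lower block.
  arrangeBlocks : (G : Graph n) → StarOnTop G → (A : Mat m) → IsoMat A (lowerBlock k<n G) →
    Σ (Permutation′ n) λ ρ →
      StarOnTop (relabel G ρ) × (lowerBlock k<n (relabel G ρ) ≐ A) ×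
      (∀ a b → 1 ≤ toℕ a → toℕ a ≤ toℕ b → row (relabel G ρ) (top a) ≤ row (relabel G ρ) (top b))
  arrangeBlocks G G★ A (τ , τ-iso)
    with sortLeaves k (λ c → binVal m (λ j → adj G (top c) (shift k<n (τ ⟨$⟩ʳ j))))
  ... | s , s-fixesCentre , s-sorts =
    blockPermutation s τ
    , relabel-starOnTop G s τ G★ s-fixesCentre
    , (λ i j → trans (lowerBlock-relabel G s τ i j) (τ-iso i j))
    , λ a b 1≤a a≤b → subst₂ _≤_ (sym (row-relabel-top G s τ a)) (sym (row-relabel-top G s τ b))
                                 (s-sorts a b 1≤a a≤b)

  module _ (G : Graph n) (G★ : StarOnTop G) where

    starOnTop-adj : ∀ {x y : Fin n} (x<k : toℕ x < k) (y<k : toℕ y < k) →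
      adj G x y ≡ isCentre (fromℕ< x<k) xor isCentre (fromℕ< y<k)
    starOnTop-adj x<k y<k =
      trans (sym (cong₂ (adj G) (top-fromℕ< x<k) (top-fromℕ< y<k))) (G★ _ _)

    starOnTop-centre : ∀ (c i : Fin n) → toℕ c ≡ 0 → 1 ≤ toℕ i → toℕ i < k → adj G c i ≡ true
    starOnTop-centre c i c≡0 1≤i i<k = trans (starOnTop-adj c<k i<k)
      (cong₂ _xor_ (isCentre-fromℕ<-zero c<k c≡0) (isCentre-fromℕ<-suc i<k 1≤i))
      where
      c<k : toℕ c < k
      c<k = subst (_< k) (sym c≡0) (<-trans 1≤i i<k)

    starOnTop-leaves : ∀ (i j : Fin n) → 1 ≤ toℕ i → toℕ i < k → 1 ≤ toℕ j → toℕ j < k →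
      adj G i j ≡ false
    starOnTop-leaves i j 1≤i i<k 1≤j j<k = trans (starOnTop-adj i<k j<k)
      (cong₂ _xor_ (isCentre-fromℕ<-suc i<k 1≤i) (isCentre-fromℕ<-suc j<k 1≤j))

  row-monotone : (G : Graph n) →
    (∀ a b → 1 ≤ toℕ a → toℕ a ≤ toℕ b → row G (top a) ≤ row G (top b)) →
    ∀ (i i′ : Fin n) → 1 ≤ toℕ i → toℕ i ≤ toℕ i′ → toℕ i′ < k → row G i ≤ row G i′
  row-monotone G sorted i i′ 1≤i i≤i′ i′<k =
    subst₂ (λ x y → row G x ≤ row G y) (top-fromℕ< i<k) (top-fromℕ< i′<k)
      (sorted _ _ (subst (1 ≤_) (sym (toℕ-fromℕ< i<k)) 1≤i)
                  (subst₂ _≤_ (sym (toℕ-fromℕ< i<k)) (sym (toℕ-fromℕ< i′<k)) i≤i′))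
    where
    i<k : toℕ i < k
    i<k = ≤-<-trans i≤i′ i′<k

mainTheorem5 : (n k : ℕ) → (k<n : k < n) → (G : Graph n) →
    (∀ (T : Graph k) → IsTree T → InducedSub T G) →
    (M : Mat (n ∸ k) → Set) →
    (∀ A → M A → IsAdjMat A) →
    (∀ (H : Mat (n ∸ k)) → IsAdjMat H → Σ (Mat (n ∸ k)) λ A → M A × IsoMat A H) →
    (∀ A B → M A → M B → IsoMat A B → A ≐ B) →
    Σ (Graph n) λ G′ →
      Iso G G′ ×
      ((∀ (c i : Fin n) → toℕ c ≡ 0 → 1 ≤ toℕ i → toℕ i < k → adj G′ c i ≡ true) ×
       (∀ (i j : Fin n) → 1 ≤ toℕ i → toℕ i < k → 1 ≤ toℕ j → toℕ j < k →
          adj G′ i j ≡ false)) ×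
      (Σ (Mat (n ∸ k)) λ A → M A × (lowerBlock k<n G′ ≐ A)) ×
      (∀ (i i′ : Fin n) → 1 ≤ toℕ i → toℕ i ≤ toℕ i′ → toℕ i′ < k →
         binVal (n ∸ k) (λ j → adj G′ i (shift k<n j))
           ≤ binVal (n ∸ k) (λ j → adj G′ i′ (shift k<n j)))
mainTheorem5 n k k<n G trees M _ representative _ =
  let open Blocks k<n
      π , G₁★ = placeStarOnTop G (trees (star k) star-isTree)
      G₁ = relabel G π
      A , A∈M , lowerBlock≅A = representative (lowerBlock k<n G₁) (lowerBlock-isAdjMat k<n G₁)
      ρ , G′★ , lowerBlock≐A , rows-sorted = arrangeBlocks G₁ G₁★ A lowerBlock≅A
      G′ = relabel G₁ ρ
  in G′ , relabel-iso G (ρ ∘ₚ π)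
        , (starOnTop-centre G′ G′★ , starOnTop-leaves G′ G′★)
        , (A , A∈M , lowerBlock≐A)
        , row-monotone G′ rows-sorted
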